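{- Let $P$ be a monic prime in $A = \mathbb{F}_q[T]$, and let $\wp_P$ be the Carlitz annihilator of $P$. Then $\wp_P$ is a prime if and only if $P$ divides $C_Q(1)$ for some monic prime $Q$ of $A$.
   Context: $q$ is a power of a prime, $A = \mathbb{F}_q[T]$. The Carlitz module is the unique $\mathbb{F}_q$-algebra homomorphism $a \mapsto C_a$ from $A$ to the ring of $\mathbb{F}_q$-linear polynomials in $A[x]$ (composition as multiplication) with $C_T(x) = Tx + x^q$; $C_a(1)$ is the value of $C_a(x)$ at $x=1$. For a monic prime $P$ of positive degree, the Carlitz annihilator of $P$ is the unique monic polynomial $\wp_P \in A$ of positive degree such that $C_{\wp_P}(1) \equiv 0 \pmod P$ and, for every nonzero $a \in A$, $\wp_P \mid a$ if and only if $C_a(1) \equiv 0 \pmod P$. -}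

module Defs where

open import Level using (Level; _⊔_; suc)
open import Data.Nat using (ℕ; zero; suc; _≤_; _<_)
open import Data.Fin using (Fin)
open import Data.List using (List; []; _∷_; map)
open import Data.Product using (Σ; ∃; _×_; _,_)
open import Data.Sum using (_⊎_)
open import Relation.Nullary using (¬_)
open import Algebra.Bundles using (CommutativeRing)
open import Function.Bundles using (Bijection)
import Relation.Binary.PropositionalEquality as ≡

-- A finite field F_q: a commutative ring with 1 ≉ 0 in which every nonzero
-- element is invertible, together with a bijection Fin q ≅ F (setoid bijection).
-- (q is then automatically a prime power.)
record FiniteField (c ℓ : Level) : Set (Level.suc (c ⊔ ℓ)) where
  field
    cring   : CommutativeRing c ℓ
  open CommutativeRing cring public
  field
    1≉0     : ¬ (1# ≈ 0#)
    inverse : ∀ x → ¬ (x ≈ 0#) → ∃ λ y → x * y ≈ 1#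
    q       : ℕ
    enum    : Bijection (≡.setoid (Fin q)) setoid

-- Polynomials A = F_q[T] as coefficient lists (constant term first),
-- compared up to trailing zeros via their coefficient functions.
module Carlitz {c ℓ : Level} (F : FiniteField c ℓ) where
  open FiniteField F

  Poly : Set c
  Poly = List Carrier

  coeff : Poly → ℕ → Carrier
  coeff []       _       = 0#
  coeff (a ∷ p)  zero    = a
  coeff (a ∷ p)  (suc n) = coeff p n

  infix 4 _≈ₚ_
  _≈ₚ_ : Poly → Poly → Set ℓ
  p ≈ₚ r = ∀ n → coeff p n ≈ coeff r n

  0ₚ : Poly
  0ₚ = []

  1ₚ : Poly
  1ₚ = 1# ∷ []

  Tₚ : Poly
  Tₚ = 0# ∷ 1# ∷ []

  infixl 6 _+ₚ_
  _+ₚ_ : Poly → Poly → Poly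
  []      +ₚ r       = r
  (a ∷ p) +ₚ []      = a ∷ p
  (a ∷ p) +ₚ (b ∷ r) = (a + b) ∷ (p +ₚ r)

  _·ₚ_ : Carrier → Poly → Poly
  a ·ₚ p = map (a *_) p

  infixl 7 _*ₚ_
  _*ₚ_ : Poly → Poly → Poly
  []      *ₚ r = []
  (a ∷ p) *ₚ r = (a ·ₚ r) +ₚ (0# ∷ (p *ₚ r))

  _^ₚ_ : Poly → ℕ → Poly
  p ^ₚ zero    = 1ₚ
  p ^ₚ (suc n) = p *ₚ (p ^ₚ n)

  infix 4 _∣ₚ_
  _∣ₚ_ : Poly → Poly → Set (c ⊔ ℓ)
  a ∣ₚ b = ∃ λ k → a *ₚ k ≈ₚ b

  MonicOfDegree : Poly → ℕ → Set ℓ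
  MonicOfDegree p d = (coeff p d ≈ 1#) × (∀ n → d < n → coeff p n ≈ 0#)

  Monic : Poly → Set ℓ
  Monic p = ∃ λ d → MonicOfDegree p d

  MonicPositiveDegree : Poly → Set ℓ
  MonicPositiveDegree p = ∃ λ d → (1 ≤ d) × MonicOfDegree p d

  IsPrime : Poly → Set (c ⊔ ℓ)
  IsPrime p = (¬ (p ≈ₚ 0ₚ)) × (¬ (p ∣ₚ 1ₚ))
              × (∀ a b → p ∣ₚ (a *ₚ b) → (p ∣ₚ a) ⊎ (p ∣ₚ b))

  MonicPrime : Poly → Set (c ⊔ ℓ)
  MonicPrime p = Monic p × IsPrime p

  -- Carlitz module: C_T(z) = T z + z^q, and C_a for a = Σ aᵢ Tⁱ is
  -- C_a(z) = Σ aᵢ C_T^i(z)  (F_q-algebra homomorphism a ↦ C_a), evaluated at z ∈ A.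
  CT : Poly → Poly
  CT z = (Tₚ *ₚ z) +ₚ (z ^ₚ q)

  -- Cev a z = C_a(z), using C_{a₀ + T a'}(z) = a₀ z + C_{a'}(C_T(z))
  Cev : Poly → Poly → Poly
  Cev []       z = []
  Cev (a ∷ as) z = (a ·ₚ z) +ₚ Cev as (CT z)

  C1 : Poly → Poly
  C1 a = Cev a 1ₚ

  IsCarlitzAnnihilator : Poly → Poly → Set (c ⊔ ℓ)
  IsCarlitzAnnihilator P w =
    MonicPositiveDegree w × (P ∣ₚ C1 w)
    × (∀ a → ¬ (a ≈ₚ 0ₚ) → ((w ∣ₚ a → P ∣ₚ C1 a) × (P ∣ₚ C1 a → w ∣ₚ a)))

{-# OPTIONS --safe #-}
-- Suppose Q is a monic prime with P ∣ C_Q(1). By the defining property of the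
-- annihilator, ℘_P ∣ Q, say Q = ℘_P k. Primality of Q gives Q ∣ ℘_P or Q ∣ k;
-- the second is impossible, since deg ℘_P ≥ 1 forces deg k < deg Q and k ≠ 0.
-- So ℘_P and Q divide each other and ℘_P is prime. Conversely, if ℘_P is prime
-- it is itself a monic prime Q with P ∣ C_Q(1).
module Submission where

open import Defs
open import Level using (Level)
open import Data.Product using (∃; _×_; _,_; proj₁; proj₂)
open import Function.Base using (_∘_)
open import Function.Bundles using (_⇔_; mk⇔)
open import Data.Nat using (ℕ; zero; suc; _≤_; s≤s; z≤n)
  renaming (_+_ to _+ℕ_)
open import Data.Nat.Properties using (m≤m+n; m≤n+m; ≤-trans; +-monoʳ-≤; +-monoˡ-≤; m≤n⇒m<n∨m≡n)
open import Data.List using ([]; _∷_; length)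
open import Data.Sum using (_⊎_; inj₁; inj₂)
open import Data.Empty using (⊥-elim)
import Relation.Binary.PropositionalEquality as ≡
open import Relation.Nullary using (¬_)
import Algebra.Properties.CommutativeSemigroup as CommutativeSemigroupProperties
import Relation.Binary.Reasoning.Setoid as SetoidReasoning

module Properties {c ℓ : Level} (F : FiniteField c ℓ) where
  open FiniteField F
  open Carlitz F
  open SetoidReasoning setoid
  open CommutativeSemigroupProperties +-commutativeSemigroup using (interchange)

  0∷-cong : ∀ {p r} → p ≈ₚ r → (0# ∷ p) ≈ₚ (0# ∷ r)
  0∷-cong p≈r zero    = refl
  0∷-cong p≈r (suc n) = p≈r n

  0∷-zero : ∀ {p} → p ≈ₚ 0ₚ → (0# ∷ p) ≈ₚ 0ₚ
  0∷-zero p≈0 zero    = refl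
  0∷-zero p≈0 (suc n) = p≈0 n

  coeff-+ₚ : ∀ p r n → coeff (p +ₚ r) n ≈ coeff p n + coeff r n
  coeff-+ₚ []      r       n       = sym (+-identityˡ _)
  coeff-+ₚ (a ∷ p) []      n       = sym (+-identityʳ _)
  coeff-+ₚ (a ∷ p) (b ∷ r) zero    = refl
  coeff-+ₚ (a ∷ p) (b ∷ r) (suc n) = coeff-+ₚ p r n

  coeff-·ₚ : ∀ a p n → coeff (a ·ₚ p) n ≈ a * coeff p n
  coeff-·ₚ a []      n       = sym (zeroʳ a)
  coeff-·ₚ a (b ∷ p) zero    = refl
  coeff-·ₚ a (b ∷ p) (suc n) = coeff-·ₚ a p n

  coeff-∷-*ₚ : ∀ a p r n → coeff ((a ∷ p) *ₚ r) n ≈ a * coeff r n + coeff (0# ∷ (p *ₚ r)) n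
  coeff-∷-*ₚ a p r n = trans (coeff-+ₚ (a ·ₚ r) (0# ∷ (p *ₚ r)) n) (+-congʳ (coeff-·ₚ a r n))

  *ₚ-zeroˡ : ∀ p r → p ≈ₚ 0ₚ → p *ₚ r ≈ₚ 0ₚ
  *ₚ-zeroˡ []      r p≈0 n = refl
  *ₚ-zeroˡ (a ∷ p) r p≈0 n = begin
    coeff ((a ∷ p) *ₚ r) n                  ≈⟨ coeff-∷-*ₚ a p r n ⟩
    a * coeff r n + coeff (0# ∷ (p *ₚ r)) n ≈⟨ +-cong (trans (*-congʳ (p≈0 0)) (zeroˡ _))
                                                      (0∷-zero (*ₚ-zeroˡ p r (p≈0 ∘ suc)) n) ⟩
    0# + 0#                                 ≈⟨ +-identityˡ 0# ⟩
    0#                                      ∎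

  *ₚ-zeroʳ : ∀ p r → r ≈ₚ 0ₚ → p *ₚ r ≈ₚ 0ₚ
  *ₚ-zeroʳ []      r r≈0 n = refl
  *ₚ-zeroʳ (a ∷ p) r r≈0 n = begin
    coeff ((a ∷ p) *ₚ r) n                  ≈⟨ coeff-∷-*ₚ a p r n ⟩
    a * coeff r n + coeff (0# ∷ (p *ₚ r)) n ≈⟨ +-cong (trans (*-congˡ (r≈0 n)) (zeroʳ a))
                                                      (0∷-zero (*ₚ-zeroʳ p r r≈0) n) ⟩
    0# + 0#                                 ≈⟨ +-identityˡ 0# ⟩
    0#                                      ∎

  *ₚ-congʳ : ∀ p p' r → p ≈ₚ p' → p *ₚ r ≈ₚ p' *ₚ r
  *ₚ-congʳ []      p'       r p≈p' n = sym (*ₚ-zeroˡ p' r (sym ∘ p≈p') n)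
  *ₚ-congʳ (a ∷ p) []       r p≈p' = *ₚ-zeroˡ (a ∷ p) r p≈p'
  *ₚ-congʳ (a ∷ p) (b ∷ p') r p≈p' n = begin
    coeff ((a ∷ p) *ₚ r) n                   ≈⟨ coeff-∷-*ₚ a p r n ⟩
    a * coeff r n + coeff (0# ∷ (p *ₚ r)) n  ≈⟨ +-cong (*-congʳ (p≈p' 0))
                                                       (0∷-cong (*ₚ-congʳ p p' r (p≈p' ∘ suc)) n) ⟩
    b * coeff r n + coeff (0# ∷ (p' *ₚ r)) n ≈⟨ coeff-∷-*ₚ b p' r n ⟨
    coeff ((b ∷ p') *ₚ r) n                  ∎

  *ₚ-identityʳ : ∀ p → p *ₚ 1ₚ ≈ₚ p
  *ₚ-identityʳ []      n       = refl
  *ₚ-identityʳ (a ∷ p) zero    = begin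
    coeff ((a ∷ p) *ₚ 1ₚ) 0 ≈⟨ coeff-∷-*ₚ a p 1ₚ 0 ⟩
    a * 1# + 0#             ≈⟨ +-identityʳ _ ⟩
    a * 1#                  ≈⟨ *-identityʳ a ⟩
    a                       ∎
  *ₚ-identityʳ (a ∷ p) (suc n) = begin
    coeff ((a ∷ p) *ₚ 1ₚ) (suc n)       ≈⟨ coeff-∷-*ₚ a p 1ₚ (suc n) ⟩
    a * coeff [] n + coeff (p *ₚ 1ₚ) n  ≈⟨ +-cong (zeroʳ a) (*ₚ-identityʳ p n) ⟩
    0# + coeff p n                      ≈⟨ +-identityˡ _ ⟩
    coeff p n                           ∎

  *ₚ-distribʳ : ∀ p r s → (p +ₚ r) *ₚ s ≈ₚ (p *ₚ s) +ₚ (r *ₚ s)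
  *ₚ-distribʳ []      r       s n = refl
  *ₚ-distribʳ (a ∷ p) []      s n = sym (trans (coeff-+ₚ ((a ∷ p) *ₚ s) [] n) (+-identityʳ _))
  *ₚ-distribʳ (a ∷ p) (b ∷ r) s n = begin
    coeff (((a + b) ∷ (p +ₚ r)) *ₚ s) n
      ≈⟨ coeff-∷-*ₚ (a + b) (p +ₚ r) s n ⟩
    (a + b) * coeff s n + coeff (0# ∷ ((p +ₚ r) *ₚ s)) n
      ≈⟨ +-cong (distribʳ _ a b) (shifted n) ⟩
    (a * coeff s n + b * coeff s n) + (coeff (0# ∷ (p *ₚ s)) n + coeff (0# ∷ (r *ₚ s)) n)
      ≈⟨ interchange _ _ _ _ ⟩
    (a * coeff s n + coeff (0# ∷ (p *ₚ s)) n) + (b * coeff s n + coeff (0# ∷ (r *ₚ s)) n)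
      ≈⟨ +-cong (coeff-∷-*ₚ a p s n) (coeff-∷-*ₚ b r s n) ⟨
    coeff ((a ∷ p) *ₚ s) n + coeff ((b ∷ r) *ₚ s) n
      ≈⟨ coeff-+ₚ ((a ∷ p) *ₚ s) ((b ∷ r) *ₚ s) n ⟨
    coeff (((a ∷ p) *ₚ s) +ₚ ((b ∷ r) *ₚ s)) n
      ∎
    where
    shifted : ∀ n → coeff (0# ∷ ((p +ₚ r) *ₚ s)) n ≈ coeff (0# ∷ (p *ₚ s)) n + coeff (0# ∷ (r *ₚ s)) n
    shifted zero    = sym (+-identityˡ 0#)
    shifted (suc n) = trans (*ₚ-distribʳ p r s n) (coeff-+ₚ (p *ₚ s) (r *ₚ s) n)

  ·ₚ-*ₚ-assoc : ∀ a r s → (a ·ₚ r) *ₚ s ≈ₚ a ·ₚ (r *ₚ s)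
  ·ₚ-*ₚ-assoc a []      s n = refl
  ·ₚ-*ₚ-assoc a (b ∷ r) s n = begin
    coeff (((a * b) ∷ (a ·ₚ r)) *ₚ s) n
      ≈⟨ coeff-∷-*ₚ (a * b) (a ·ₚ r) s n ⟩
    (a * b) * coeff s n + coeff (0# ∷ ((a ·ₚ r) *ₚ s)) n
      ≈⟨ +-cong (*-assoc a b _) (shifted n) ⟩
    a * (b * coeff s n) + a * coeff (0# ∷ (r *ₚ s)) n
      ≈⟨ distribˡ a _ _ ⟨
    a * (b * coeff s n + coeff (0# ∷ (r *ₚ s)) n)
      ≈⟨ *-congˡ (coeff-∷-*ₚ b r s n) ⟨
    a * coeff ((b ∷ r) *ₚ s) n
      ≈⟨ coeff-·ₚ a ((b ∷ r) *ₚ s) n ⟨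
    coeff (a ·ₚ ((b ∷ r) *ₚ s)) n
      ∎
    where
    shifted : ∀ n → coeff (0# ∷ ((a ·ₚ r) *ₚ s)) n ≈ a * coeff (0# ∷ (r *ₚ s)) n
    shifted zero    = sym (zeroʳ a)
    shifted (suc n) = trans (·ₚ-*ₚ-assoc a r s n) (coeff-·ₚ a (r *ₚ s) n)

  *ₚ-assoc : ∀ p r s → (p *ₚ r) *ₚ s ≈ₚ p *ₚ (r *ₚ s)
  *ₚ-assoc []      r s n = refl
  *ₚ-assoc (a ∷ p) r s n = begin
    coeff (((a ·ₚ r) +ₚ (0# ∷ (p *ₚ r))) *ₚ s) n
      ≈⟨ *ₚ-distribʳ (a ·ₚ r) (0# ∷ (p *ₚ r)) s n ⟩
    coeff (((a ·ₚ r) *ₚ s) +ₚ ((0# ∷ (p *ₚ r)) *ₚ s)) n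
      ≈⟨ coeff-+ₚ ((a ·ₚ r) *ₚ s) ((0# ∷ (p *ₚ r)) *ₚ s) n ⟩
    coeff ((a ·ₚ r) *ₚ s) n + coeff ((0# ∷ (p *ₚ r)) *ₚ s) n
      ≈⟨ +-cong (trans (·ₚ-*ₚ-assoc a r s n) (coeff-·ₚ a (r *ₚ s) n)) (coeff-∷-*ₚ 0# (p *ₚ r) s n) ⟩
    a * coeff (r *ₚ s) n + (0# * coeff s n + coeff (0# ∷ ((p *ₚ r) *ₚ s)) n)
      ≈⟨ +-congˡ (+-cong (zeroˡ _) (0∷-cong (*ₚ-assoc p r s) n)) ⟩
    a * coeff (r *ₚ s) n + (0# + coeff (0# ∷ (p *ₚ (r *ₚ s))) n)
      ≈⟨ +-congˡ (+-identityˡ _) ⟩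
    a * coeff (r *ₚ s) n + coeff (0# ∷ (p *ₚ (r *ₚ s))) n
      ≈⟨ coeff-∷-*ₚ a p (r *ₚ s) n ⟨
    coeff ((a ∷ p) *ₚ (r *ₚ s)) n
      ∎

  ∣ₚ-refl : ∀ p → p ∣ₚ p
  ∣ₚ-refl p = 1ₚ , *ₚ-identityʳ p

  ∣ₚ-respʳ : ∀ p r s → r ≈ₚ s → p ∣ₚ r → p ∣ₚ s
  ∣ₚ-respʳ p r s r≈s (k , pk≈r) = k , λ n → trans (pk≈r n) (r≈s n)

  ∣ₚ-trans : ∀ p r s → p ∣ₚ r → r ∣ₚ s → p ∣ₚ s
  ∣ₚ-trans p r s (k , pk≈r) (l , rl≈s) = k *ₚ l , λ n → begin
    coeff (p *ₚ (k *ₚ l)) n ≈⟨ *ₚ-assoc p k l n ⟨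
    coeff ((p *ₚ k) *ₚ l) n ≈⟨ *ₚ-congʳ (p *ₚ k) r l pk≈r n ⟩
    coeff (r *ₚ l) n        ≈⟨ rl≈s n ⟩
    coeff s n               ∎

  isPrime-associate : ∀ p r → IsPrime p → p ∣ₚ r → r ∣ₚ p → IsPrime r
  isPrime-associate p r (p≉0 , p∤1 , p-prime) p∣r r∣p@(k , rk≈p) = r≉0 , r∤1 , r-prime
    where
    r≉0 : ¬ (r ≈ₚ 0ₚ)
    r≉0 r≈0 = p≉0 (λ n → trans (sym (rk≈p n)) (*ₚ-zeroˡ r k r≈0 n))
    r∤1 : ¬ (r ∣ₚ 1ₚ)
    r∤1 r∣1 = p∤1 (∣ₚ-trans p r 1ₚ p∣r r∣1)
    r-prime : ∀ a b → r ∣ₚ a *ₚ b → (r ∣ₚ a) ⊎ (r ∣ₚ b)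
    r-prime a b r∣ab with p-prime a b (∣ₚ-trans p r (a *ₚ b) p∣r r∣ab)
    ... | inj₁ p∣a = inj₁ (∣ₚ-trans r p a r∣p p∣a)
    ... | inj₂ p∣b = inj₂ (∣ₚ-trans r p b r∣p p∣b)

  VanishesFrom : Poly → ℕ → Set ℓ
  VanishesFrom p b = ∀ j → b ≤ j → coeff p j ≈ 0#

  vanishesFrom-mono : ∀ p {b b'} → b ≤ b' → VanishesFrom p b → VanishesFrom p b'
  vanishesFrom-mono p b≤b' v j b'≤j = v j (≤-trans b≤b' b'≤j)

  vanishesFrom-length : ∀ p → VanishesFrom p (length p)
  vanishesFrom-length []      j       _         = refl
  vanishesFrom-length (a ∷ p) (suc j) (s≤s p≤j) = vanishesFrom-length p j p≤j

  vanishesFrom-descent : ∀ p b → (∀ n → b ≤ n → VanishesFrom p (suc n) → coeff p n ≈ 0#) →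
                         VanishesFrom p b
  vanishesFrom-descent p b step =
    lower (length p) (vanishesFrom-mono p (m≤m+n (length p) b) (vanishesFrom-length p))
    where
    lower : ∀ t → VanishesFrom p (t +ℕ b) → VanishesFrom p b
    lower zero    v = v
    lower (suc t) v = lower t v'
      where
      v' : VanishesFrom p (t +ℕ b)
      v' j t+b≤j with m≤n⇒m<n∨m≡n t+b≤j
      ... | inj₁ t+b<j  = v j t+b<j
      ... | inj₂ ≡.refl = step (t +ℕ b) (m≤n+m b t) v

  monic-*ₚ-coeff : ∀ w d p n → MonicOfDegree w d → VanishesFrom p (suc n) →
                   coeff (w *ₚ p) (d +ℕ n) ≈ coeff p n
  monic-*ₚ-coeff []      d       p n (w₁ , _)   v = ⊥-elim (1≉0 (sym w₁))
  monic-*ₚ-coeff (a ∷ w) zero    p n (a≈1 , w≈0) v = begin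
    coeff ((a ∷ w) *ₚ p) n                  ≈⟨ coeff-∷-*ₚ a w p n ⟩
    a * coeff p n + coeff (0# ∷ (w *ₚ p)) n ≈⟨ +-cong (*-congʳ a≈1)
                                                      (0∷-zero (*ₚ-zeroˡ w p λ m → w≈0 (suc m) (s≤s z≤n)) n) ⟩
    1# * coeff p n + 0#                     ≈⟨ +-identityʳ _ ⟩
    1# * coeff p n                          ≈⟨ *-identityˡ _ ⟩
    coeff p n                               ∎
  monic-*ₚ-coeff (a ∷ w) (suc d) p n (w₁ , w₀) v = begin
    coeff ((a ∷ w) *ₚ p) (suc (d +ℕ n))                    ≈⟨ coeff-∷-*ₚ a w p (suc (d +ℕ n)) ⟩
    a * coeff p (suc (d +ℕ n)) + coeff (w *ₚ p) (d +ℕ n)  ≈⟨ +-cong (*-congˡ (v _ (s≤s (m≤n+m n d))))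
                                                                     (monic-*ₚ-coeff w d p n (w₁ , λ m → w₀ (suc m) ∘ s≤s) v) ⟩
    a * 0# + coeff p n                                     ≈⟨ +-congʳ (zeroʳ a) ⟩
    0# + coeff p n                                         ≈⟨ +-identityˡ _ ⟩
    coeff p n                                              ∎

  monic-*ₚ-reflects-vanishing : ∀ w d p b → MonicOfDegree w d →
                                VanishesFrom (w *ₚ p) (d +ℕ b) → VanishesFrom p b
  monic-*ₚ-reflects-vanishing w d p b w-monic v = vanishesFrom-descent p b λ n b≤n vₙ →
    trans (sym (monic-*ₚ-coeff w d p n w-monic vₙ)) (v (d +ℕ n) (+-monoʳ-≤ d b≤n))

  monic-∣-vanishing⇒zero : ∀ q e k → MonicOfDegree q e → VanishesFrom k e → q ∣ₚ k → k ≈ₚ 0ₚ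
  monic-∣-vanishing⇒zero q e k q-monic k-small (m , qm≈k) n = begin
    coeff k n         ≈⟨ qm≈k n ⟨
    coeff (q *ₚ m) n  ≈⟨ *ₚ-zeroʳ q m m≈0 n ⟩
    0#                ∎
    where
    qm-small : VanishesFrom (q *ₚ m) (e +ℕ 0)
    qm-small j e≤j = trans (qm≈k j) (k-small j (≤-trans (m≤m+n e 0) e≤j))
    m≈0 : m ≈ₚ 0ₚ
    m≈0 j = monic-*ₚ-reflects-vanishing q e m 0 q-monic qm-small j z≤n

  monicPrime-∣-of-monic-divisor : ∀ q e w d → MonicOfDegree q e → IsPrime q →
                                   MonicOfDegree w d → 1 ≤ d → w ∣ₚ q → q ∣ₚ w
  monicPrime-∣-of-monic-divisor q e w d q-monic (q≉0 , _ , q-prime) w-monic 1≤d (k , wk≈q)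
    with q-prime w k (∣ₚ-respʳ q q (w *ₚ k) (λ n → sym (wk≈q n)) (∣ₚ-refl q))
  ... | inj₁ q∣w = q∣w
  ... | inj₂ q∣k = ⊥-elim (q≉0 λ n → trans (sym (wk≈q n)) (*ₚ-zeroʳ w k k≈0 n))
    where
    wk-small : VanishesFrom (w *ₚ k) (d +ℕ e)
    wk-small j d+e≤j = trans (wk≈q j) (proj₂ q-monic j (≤-trans (+-monoˡ-≤ e 1≤d) d+e≤j))
    k≈0 : k ≈ₚ 0ₚ
    k≈0 = monic-∣-vanishing⇒zero q e k q-monic
            (monic-*ₚ-reflects-vanishing w d k e w-monic wk-small) q∣k

corollary4p6 : {c ℓ : Level} (F : FiniteField c ℓ) → let open Carlitz F in
    (P : Poly) → MonicPrime P → MonicPositiveDegree P →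
    (w : Poly) → IsCarlitzAnnihilator P w →
    (IsPrime w ⇔ (∃ λ Q → MonicPrime Q × (P ∣ₚ C1 Q)))
-- Nothing about P is used beyond the defining property of its annihilator w.
corollary4p6 F P _ _ w ((d , 1≤d , w-monic) , P∣C₍w₎1 , annihilates) =
  mk⇔ (λ w-prime → w , ((d , w-monic) , w-prime) , P∣C₍w₎1) prime-from-witness
  where
  open Carlitz F
  open Properties F
  prime-from-witness : (∃ λ Q → MonicPrime Q × (P ∣ₚ C1 Q)) → IsPrime w
  prime-from-witness (Q , ((e , Q-monic) , Q-prime) , P∣C₍Q₎1) =
    isPrime-associate Q w Q-prime Q∣w w∣Q
    where
    w∣Q : w ∣ₚ Q
    w∣Q = proj₂ (annihilates Q (proj₁ Q-prime)) P∣C₍Q₎1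
    Q∣w : Q ∣ₚ w
    Q∣w = monicPrime-∣-of-monic-divisor Q e w d Q-monic Q-prime w-monic 1≤d w∣Q
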